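{- Let $A, B$ be sets with $\mathbf{P}(B) \subseteq \mathcal{P}(B) \setminus \{\varnothing\}$, and let $R \subseteq A \times B$. Then $R$ is belief-complete with respect to $\mathbf{P}(B)$ if and only if the following holds: for every set $C$, every $\mathbf{P}(C) \subseteq \mathcal{P}(C) \setminus \{\varnothing\}$, and every relation $S \subseteq B \times C$ such that (1) $S$ is assumption-complete with respect to $\mathbf{P}(C)$ and (2) $\boxplus_S p \in \mathbf{P}(B)$ for every $p \in \mathbf{P}(C)$, the relational composition $R ; S \subseteq A \times C$ is assumption-complete with respect to $\mathbf{P}(C)$.
   Context: Every set $X$ considered is equipped with a set $\mathbf{P}(X) \subseteq \mathcal{P}(X) \setminus \{\varnothing\}$ of non-empty predicates. For $R \subseteq X \times Y$: $R$ is assumption-complete with respect to $\mathbf{P}(Y)$ if for every $p \in \mathbf{P}(Y)$ there is $x \in X$ with $\{y \mid R(x,y)\} = p$; $R$ is belief-complete with respect to $\mathbf{P}(Y)$ if for every $p \in \mathbf{P}(Y)$ there is $x \in X$ with $\varnothing \neq \{y \mid R(x,y)\} \subseteq p$. For $S \subseteq B \times C$ and $p \subseteq C$, $\boxplus_S p = \{ y \in B \mid \{z \mid S(y,z)\} = p\}$. The relational composition is $(R;S)(x,z) \iff \exists y.\,[R(x,y) \wedge S(y,z)]$. -}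

module Defs where

open import Level using (0ℓ)
open import Data.Product using (∃; _×_)
open import Relation.Unary using (Pred; _⊆_; _≐_; Satisfiable)
open import Relation.Binary.Core using (REL)

-- Subsets of a type are
-- predicates; since predicates are only extensionally identified, the
-- family must respect extensional equality (automatic for sets).
record PredFamily (X : Set) : Set₁ where
  field
    pred     : Pred (Pred X 0ℓ) 0ℓ
    nonempty : ∀ p → pred p → Satisfiable p
    respects : ∀ p q → p ≐ q → pred p → pred q
open PredFamily public

section : ∀ {X Y : Set} → REL X Y 0ℓ → X → Pred Y 0ℓ
section R x = λ y → R x y

AssumptionComplete : ∀ {X Y : Set} → REL X Y 0ℓ → PredFamily Y → Set₁
AssumptionComplete {X} R P =
  ∀ p → pred P p → ∃ λ (x : X) → section R x ≐ p

BeliefComplete : ∀ {X Y : Set} → REL X Y 0ℓ → PredFamily Y → Set₁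
BeliefComplete {X} R P =
  ∀ p → pred P p → ∃ λ (x : X) → Satisfiable (section R x) × (section R x ⊆ p)

⊞ : ∀ {B C : Set} → REL B C 0ℓ → Pred C 0ℓ → Pred B 0ℓ
⊞ S p = λ y → section S y ≐ p

compose : ∀ {A B C : Set} → REL A B 0ℓ → REL B C 0ℓ → REL A C 0ℓ
compose {B = B} R S = λ x z → ∃ λ (y : B) → R x y × S y z

-- (⇒) A belief x for the predicate ⊞_S p is an assumption for p in R;S:
-- every S-successor of a world x considers possible sees exactly p.
-- (⇐) Given p ∈ P(B), take C = B, P(C) = {p}, and let S merge the worlds of p
-- into one class while keeping every other world a singleton. Then ⊞_S p = p,
-- and an assumption x for p in R;S must have its R-section inside p, since
-- each world outside p is S-related only to itself.
module Submission where

open import Defs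
open import Level using (0ℓ)
open import Function.Bundles using (_⇔_; mk⇔)
open import Relation.Binary.Core using (REL)
open import Relation.Binary.PropositionalEquality using (_≡_; refl)
open import Data.Product using (_,_; _×_; proj₁; proj₂)
open import Data.Sum using (_⊎_; inj₁; inj₂)
open import Relation.Unary using (Pred; _≐_; _⊆_; Satisfiable)
open import Relation.Unary.Properties using (≐-refl; ≐-sym; ≐-trans)

section-compose-≐ : ∀ {A B C : Set} (R : REL A B 0ℓ) {S : REL B C 0ℓ} {p : Pred C 0ℓ} {x : A} →
  Satisfiable (section R x) → section R x ⊆ ⊞ S p → section (compose R S) x ≐ p
section-compose-≐ R (y , rxy) sub =
  (λ { (y′ , rxy′ , sy′z) → proj₁ (sub rxy′) sy′z })
  , λ pz → y , rxy , proj₂ (sub rxy) pz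

beliefComplete⇒compose-assumptionComplete :
  ∀ {A B C : Set} {PB : PredFamily B} {PC : PredFamily C} (R : REL A B 0ℓ) (S : REL B C 0ℓ) →
  BeliefComplete R PB → (∀ p → pred PC p → pred PB (⊞ S p)) →
  AssumptionComplete (compose R S) PC
beliefComplete⇒compose-assumptionComplete R S bc ⊞-closed p pp
  with bc _ (⊞-closed p pp)
... | x , nonempty-x , sub = x , section-compose-≐ R nonempty-x sub

≐-family : ∀ {X : Set} (p : Pred X 0ℓ) → Satisfiable p → PredFamily X
≐-family p (z , pz) = record
  { pred     = λ q → q ≐ p
  ; nonempty = λ q q≐p → z , proj₂ q≐p pz
  ; respects = λ q r q≐r q≐p → ≐-trans (≐-sym q≐r) q≐p
  }

merge : ∀ {X : Set} → Pred X 0ℓ → REL X X 0ℓ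
merge p y z = (p y × p z) ⊎ y ≡ z

section-merge : ∀ {X : Set} {p : Pred X 0ℓ} {y : X} → p y → section (merge p) y ≐ p
section-merge py = (λ { (inj₁ (_ , pz)) → pz ; (inj₂ refl) → py }) , λ pz → inj₁ (py , pz)

⊞-merge : ∀ {X : Set} {p q : Pred X 0ℓ} → q ≐ p → ⊞ (merge p) q ≐ p
⊞-merge q≐p =
  (λ sy≐q → proj₁ q≐p (proj₁ sy≐q (inj₂ refl)))
  , λ py → ≐-trans (section-merge py) (≐-sym q≐p)

merge-assumptionComplete : ∀ {X : Set} {p : Pred X 0ℓ} (sat : Satisfiable p) →
  AssumptionComplete (merge p) (≐-family p sat)
merge-assumptionComplete (y , py) q q≐p = y , ≐-trans (section-merge py) (≐-sym q≐p)

section-compose-merge : ∀ {A B : Set} (R : REL A B 0ℓ) {p : Pred B 0ℓ} {x : A} →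
  Satisfiable p → section (compose R (merge p)) x ≐ p →
  Satisfiable (section R x) × section R x ⊆ p
section-compose-merge R (z , pz) (⊆p , ⊇p) with ⊇p pz
... | y , rxy , _ = (y , rxy) , λ {y′} rxy′ → ⊆p (y′ , rxy′ , inj₂ refl)

compose-assumptionComplete⇒beliefComplete : ∀ {A B : Set} {PB : PredFamily B} (R : REL A B 0ℓ) →
  ((PC : PredFamily B) (S : REL B B 0ℓ) → AssumptionComplete S PC →
    (∀ p → pred PC p → pred PB (⊞ S p)) → AssumptionComplete (compose R S) PC) →
  BeliefComplete R PB
compose-assumptionComplete⇒beliefComplete {PB = PB} R composite p pp =
  let sat = nonempty PB p pp
      x , x≐p = composite (≐-family p sat) (merge p) (merge-assumptionComplete sat)
                  (λ q q≐p → respects PB p _ (≐-sym (⊞-merge q≐p)) pp)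
                  p ≐-refl
  in x , section-compose-merge R sat x≐p

theorem1 : (A B : Set) (PB : PredFamily B) (R : REL A B 0ℓ) →
    BeliefComplete R PB ⇔
      ((C : Set) (PC : PredFamily C) (S : REL B C 0ℓ) →
        AssumptionComplete S PC →
        (∀ p → pred PC p → pred PB (⊞ S p)) →
        AssumptionComplete (compose R S) PC)
theorem1 A B PB R = mk⇔
  (λ bc C PC S _ → beliefComplete⇒compose-assumptionComplete {PB = PB} {PC} R S bc)
  (λ composite → compose-assumptionComplete⇒beliefComplete {PB = PB} R (composite B))
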